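{- There exist infinitely many triangulations $G$ in which every vertex has even degree and $\gamma(G) = |V(G)|/4$.
   Context: A triangulation is a 2-connected plane graph in which every bounded face is bounded by a triangle and exactly three vertices lie on the unbounded face (equivalently, a maximal planar graph with a fixed embedding). $\gamma(G)$ is the minimum size of a dominating set of $G$. -}

module Defs where

open import Data.Nat using (ℕ; zero; suc; _+_; _*_; _≤_; _<_; _/_)
open import Data.Nat.Divisibility using (_∣_)
open import Data.Fin using (Fin; _≟_)
open import Data.Fin.Subset using (Subset; _∈_; ∣_∣)
open import Data.List using (List; []; _∷_; length)
open import Data.Nat.ListAction using (sum)
open import Data.List.Relation.Unary.Unique.Propositional using (Unique)
import Data.List.Membership.Propositional as LM
open import Data.Vec using (tabulate; toList)
open import Data.Bool using (if_then_else_)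
open import Data.Product using (Σ; _×_; ∃)
open import Data.Sum using (_⊎_)
open import Relation.Nullary using (¬_; does)
open import Relation.Binary.PropositionalEquality using (_≡_)

-- A plane graph is encoded by a rotation system: vertices are Fin n and
-- rot v lists the neighbours of v in cyclic (say clockwise) order around v.
RotationSystem : ℕ → Set
RotationSystem n = Fin n → List (Fin n)

Adj : ∀ {n} → RotationSystem n → Fin n → Fin n → Set
Adj rot u v = v LM.∈ rot u

-- the element following u in the cyclic list (h ∷ ...); h is the list head
nextGo : ∀ {n} → Fin n → Fin n → List (Fin n) → Fin n
nextGo h u [] = u
nextGo h u (x ∷ []) = if does (x ≟ u) then h else u
nextGo h u (x ∷ y ∷ ys) = if does (x ≟ u) then y else nextGo h u (y ∷ ys)

cyclicNext : ∀ {n} → List (Fin n) → Fin n → Fin n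
cyclicNext [] u = u
cyclicNext (h ∷ t) u = nextGo h u (h ∷ t)

degree : ∀ {n} → RotationSystem n → Fin n → ℕ
degree rot v = length (rot v)

-- number of darts (= sum of degrees = 2|E|)
darts : ∀ {n} → RotationSystem n → ℕ
darts {n} rot = sum (toList (tabulate (degree rot)))

numEdges : ∀ {n} → RotationSystem n → ℕ
numEdges rot = darts rot / 2

-- Face tracing: the face permutation sends the dart (u,v) to (v, next_v(u)).
-- Every face is a triangle: applying the face permutation three times
-- returns to the starting dart (equivalently, for every dart (u,v) with
-- w = next_v(u) we have next_w(v) = u, and then next_u(w) = v).
AllFacesTriangles : ∀ {n} → RotationSystem n → Set
AllFacesTriangles rot =
  ∀ u v → Adj rot u v →
    cyclicNext (rot (cyclicNext (rot v) u)) v ≡ u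

-- When all faces are triangles, the faces partition the darts into triples.
numFaces : ∀ {n} → RotationSystem n → ℕ
numFaces rot = darts rot / 3

data Reach {n} (rot : RotationSystem n) (u : Fin n) : Fin n → Set where
  here : Reach rot u u
  step : ∀ {v w} → Reach rot u v → Adj rot v w → Reach rot u w

-- A triangulation: a simple connected graph with a rotation system of
-- genus 0 (Euler's formula V - E + F = 2) in which every face is a triangle.
record Triangulation : Set where
  field
    n        : ℕ
    rot      : RotationSystem n
    noLoops  : ∀ v → ¬ Adj rot v v
    noMulti  : ∀ v → Unique (rot v)
    symm     : ∀ u v → Adj rot u v → Adj rot v u
    connected : ∀ u v → Reach rot u v
    triangular : AllFacesTriangles rot
    euler    : n + numFaces rot ≡ numEdges rot + 2

Dominating : ∀ {n} → RotationSystem n → Subset n → Set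
Dominating {n} rot S = ∀ (v : Fin n) → v ∈ S ⊎ (Σ (Fin n) λ u → u ∈ S × Adj rot v u)

DominationNumber : ∀ {n} → RotationSystem n → ℕ → Set
DominationNumber {n} rot k =
  (Σ (Subset n) λ S → Dominating rot S × ∣ S ∣ ≡ k) ×
  (∀ (S : Subset n) → Dominating rot S → k ≤ ∣ S ∣)

AllDegreesEven : Triangulation → Set
AllDegreesEven G = ∀ v → 2 ∣ degree (Triangulation.rot G) v

{-# OPTIONS --safe #-}
-- Octahedral insertion into a face a b c of a triangulation (three new mutually adjacent vertices,
-- each joined to two corners) keeps it a triangulation and adds 2 to the degrees of a, b, c,
-- so starting from the triangle all degrees stay even. One round adds twelve vertices: an
-- octahedron x y z in a face whose corners are already dominators, then three nested octahedra
-- inside x y z. The nine innermost vertices have all their neighbours among these twelve; an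
-- exhaustive check shows that dominating them takes three of the twelve, while x, y, z dominate
-- all of them (the first round is the triple insertion into the triangle itself). Old vertices off
-- the attaching face gain no neighbours, so each round raises γ by exactly 3 and γ = n / 4 throughout.
module Submission where

open import Data.Bool using (true; false; if_then_else_)
open import Data.Empty using (⊥-elim)
open import Data.Fin using (Fin; zero; suc; _≟_; _↑ˡ_; _↑ʳ_; #_; splitAt; join)
open import Data.Fin.Properties using (↑ʳ-injective; suc-injective; all?; join-splitAt)
open import Data.Fin.Subset using (Subset; _∈_; _∉_; ∣_∣; ⊥; ⊤)
open import Data.Fin.Subset.Properties using (_∈?_; anySubset?; ∉⊥; ∈⊤)
open import Data.List using (List; []; _∷_; map; length)
open import Data.List.Membership.Propositional using (find; lose) renaming (_∈_ to _∈ₗ_; _∉_ to _∉ₗ_)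
open import Data.List.Membership.Propositional.Properties using (∈-map⁺; ∈-map⁻)
import Data.List.Membership.DecPropositional as DecMembership
open import Data.List.Properties using (length-map)
open import Data.List.Relation.Unary.All as All using ([]; _∷_)
open import Data.List.Relation.Unary.All.Properties using (¬Any⇒All¬)
open import Data.List.Relation.Unary.AllPairs using ([]; _∷_)
open import Data.List.Relation.Unary.Any using (Any; here; there; any?)
open import Data.List.Relation.Unary.Unique.Propositional using (Unique)
open import Data.List.Relation.Unary.Unique.Propositional.Properties using (map⁺)
open import Data.Nat using (ℕ; zero; suc; _+_; _*_; _≤_; _<_; _/_; z≤n; s≤s)
open import Data.Nat.DivMod using (+-distrib-/-∣ʳ)
open import Data.Nat.Divisibility using (_∣_; divides; ∣m∣n⇒∣m+n)
open import Data.Nat.ListAction using (sum)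
open import Data.Nat.Properties
  using (+-identityʳ; +-comm; +-commutativeSemigroup; +-mono-≤; ≤-trans; m≤n+m; m≤n*m; _<?_; ≮⇒≥)
open import Data.Nat.Tactic.RingSolver using (solve-∀)
open import Algebra.Properties.CommutativeSemigroup +-commutativeSemigroup using (interchange)
open import Data.Product using (Σ; _×_; _,_)
open import Data.Sum using (_⊎_; inj₁; inj₂)
open import Data.Vec using (Vec; []; _∷_; _++_; lookup; tabulate; toList)
  renaming (here to hereᵥ; there to thereᵥ)
import Data.Vec as Vec
open import Data.Vec.Properties using (lookup∘tabulate; lookup-map)
open import Defs
open import Function using (_∘_)
open import Function.Definitions using (Injective)
open import Relation.Binary.PropositionalEquality
  using (_≡_; _≢_; refl; sym; trans; cong; cong₂; subst; subst₂; module ≡-Reasoning)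
open import Relation.Nullary using (¬_; Dec; does; yes; no)
open import Relation.Nullary.Decidable using (_×-dec_; _⊎-dec_; from-yes; from-no)

-- Cyclic successors in rotation lists

module _ {n : ℕ} where

  headOr : Fin n → List (Fin n) → Fin n
  headOr h []      = h
  headOr h (y ∷ _) = y

  nextGo-skip : ∀ h w x (M : List (Fin n)) → x ≢ w → nextGo h w (x ∷ M) ≡ nextGo h w M
  nextGo-skip h w x []      x≢w with x ≟ w
  ... | yes x≡w = ⊥-elim (x≢w x≡w)
  ... | no _    = refl
  nextGo-skip h w x (_ ∷ _) x≢w with x ≟ w
  ... | yes x≡w = ⊥-elim (x≢w x≡w)
  ... | no _    = refl

  nextGo-hit : ∀ h w (M : List (Fin n)) → nextGo h w (w ∷ M) ≡ headOr h M
  nextGo-hit h w []      with w ≟ w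
  ... | yes _   = refl
  ... | no w≢w  = ⊥-elim (w≢w refl)
  nextGo-hit h w (_ ∷ _) with w ≟ w
  ... | yes _   = refl
  ... | no w≢w  = ⊥-elim (w≢w refl)

  nextGo-∉ : ∀ h u (L : List (Fin n)) → u ∉ₗ L → nextGo h u L ≡ u
  nextGo-∉ h u []       _   = refl
  nextGo-∉ h u (x ∷ xs) u∉L =
    trans (nextGo-skip h u x xs (λ x≡u → u∉L (here (sym x≡u)))) (nextGo-∉ h u xs (u∉L ∘ there))

  cyclicNext-∉ : ∀ u (L : List (Fin n)) → u ∉ₗ L → cyclicNext L u ≡ u
  cyclicNext-∉ u []       _   = refl
  cyclicNext-∉ u (x ∷ xs) u∉L = nextGo-∉ x u (x ∷ xs) u∉L

  cyclicNext≢⇒∈ : ∀ (L : List (Fin n)) u → cyclicNext L u ≢ u → u ∈ₗ L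
  cyclicNext≢⇒∈ L u moved with DecMembership._∈?_ _≟_ u L
  ... | yes u∈L = u∈L
  ... | no  u∉L = ⊥-elim (moved (cyclicNext-∉ u L u∉L))

  insertAfter : Fin n → Fin n → Fin n → List (Fin n) → List (Fin n)
  insertAfter c p q []       = []
  insertAfter c p q (x ∷ xs) = if does (x ≟ c) then x ∷ p ∷ q ∷ xs else x ∷ insertAfter c p q xs

  module _ (c p q : Fin n) where

    private
      ins : List (Fin n) → List (Fin n)
      ins = insertAfter c p q

      cyclicNext-ins : ∀ x xs u → cyclicNext (ins (x ∷ xs)) u ≡ nextGo x u (ins (x ∷ xs))
      cyclicNext-ins x xs u with x ≟ c
      ... | yes _ = refl
      ... | no _  = refl

      headOr-ins : ∀ h xs → headOr h (ins xs) ≡ headOr h xs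
      headOr-ins h []       = refl
      headOr-ins h (x ∷ xs) with x ≟ c
      ... | yes _ = refl
      ... | no _  = refl

    cyclicNext-insertAfter-anchor : ∀ L → c ∈ₗ L → cyclicNext (insertAfter c p q L) c ≡ p
    cyclicNext-insertAfter-anchor (x ∷ xs) c∈L = trans (cyclicNext-ins x xs c) (go x (x ∷ xs) c∈L)
      where
      go : ∀ h L → c ∈ₗ L → nextGo h c (ins L) ≡ p
      go h (y ∷ ys) c∈L with y ≟ c | c∈L
      ... | yes refl | _          = nextGo-hit h y (p ∷ q ∷ ys)
      ... | no y≢c   | here c≡y   = ⊥-elim (y≢c (sym c≡y))
      ... | no y≢c   | there c∈ys = trans (nextGo-skip h c y (ins ys) y≢c) (go h ys c∈ys)

    cyclicNext-insertAfter-first : ∀ L → c ∈ₗ L → p ∉ₗ L → cyclicNext (insertAfter c p q L) p ≡ q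
    cyclicNext-insertAfter-first (x ∷ xs) c∈L p∉L = trans (cyclicNext-ins x xs p) (go x (x ∷ xs) c∈L p∉L)
      where
      go : ∀ h L → c ∈ₗ L → p ∉ₗ L → nextGo h p (ins L) ≡ q
      go h (y ∷ ys) c∈L p∉L with y ≟ c | c∈L
      ... | yes refl | _          =
        trans (nextGo-skip h p y (p ∷ q ∷ ys) (λ y≡p → p∉L (here (sym y≡p)))) (nextGo-hit h p (q ∷ ys))
      ... | no y≢c   | here c≡y   = ⊥-elim (y≢c (sym c≡y))
      ... | no y≢c   | there c∈ys =
        trans (nextGo-skip h p y (ins ys) (λ y≡p → p∉L (here (sym y≡p)))) (go h ys c∈ys (p∉L ∘ there))

    cyclicNext-insertAfter-second : ∀ L → c ∈ₗ L → q ∉ₗ L → p ≢ q →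
                                    cyclicNext (insertAfter c p q L) q ≡ cyclicNext L c
    cyclicNext-insertAfter-second (x ∷ xs) c∈L q∉L p≢q = trans (cyclicNext-ins x xs q) (go x (x ∷ xs) c∈L q∉L)
      where
      go : ∀ h L → c ∈ₗ L → q ∉ₗ L → nextGo h q (ins L) ≡ nextGo h c L
      go h (y ∷ ys) c∈L q∉L with y ≟ c | c∈L
      ... | yes refl | _          =
        trans (nextGo-skip h q y (p ∷ q ∷ ys) (λ y≡q → q∉L (here (sym y≡q))))
          (trans (nextGo-skip h q p (q ∷ ys) p≢q) (trans (nextGo-hit h q ys) (sym (nextGo-hit h y ys))))
      ... | no y≢c   | here c≡y   = ⊥-elim (y≢c (sym c≡y))
      ... | no y≢c   | there c∈ys =
        trans (nextGo-skip h q y (ins ys) (λ y≡q → q∉L (here (sym y≡q))))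
          (trans (go h ys c∈ys (q∉L ∘ there)) (sym (nextGo-skip h c y ys y≢c)))

    cyclicNext-insertAfter-other : ∀ L w → w ≢ c → w ≢ p → w ≢ q →
                                   cyclicNext (insertAfter c p q L) w ≡ cyclicNext L w
    cyclicNext-insertAfter-other []       w _ _ _ = refl
    cyclicNext-insertAfter-other (x ∷ xs) w w≢c w≢p w≢q = trans (cyclicNext-ins x xs w) (go x (x ∷ xs))
      where
      go : ∀ h L → nextGo h w (ins L) ≡ nextGo h w L
      go h []       = refl
      go h (y ∷ ys) with y ≟ c
      ... | yes refl =
        trans (nextGo-skip h w y (p ∷ q ∷ ys) (w≢c ∘ sym))
          (trans (nextGo-skip h w p (q ∷ ys) (w≢p ∘ sym))
            (trans (nextGo-skip h w q ys (w≢q ∘ sym)) (sym (nextGo-skip h w y ys (w≢c ∘ sym)))))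
      ... | no y≢c with y ≟ w
      ...   | yes refl = trans (nextGo-hit h y (ins ys)) (trans (headOr-ins h ys) (sym (nextGo-hit h y ys)))
      ...   | no y≢w   = trans (nextGo-skip h w y (ins ys) y≢w) (trans (go h ys) (sym (nextGo-skip h w y ys y≢w)))

    ∈-insertAfter⁺ : ∀ {w} L → w ∈ₗ L → w ∈ₗ insertAfter c p q L
    ∈-insertAfter⁺ (x ∷ xs) w∈L with x ≟ c | w∈L
    ... | yes _ | here w≡x   = here w≡x
    ... | yes _ | there w∈xs = there (there (there w∈xs))
    ... | no _  | here w≡x   = here w≡x
    ... | no _  | there w∈xs = there (∈-insertAfter⁺ xs w∈xs)

    first∈insertAfter : ∀ L → c ∈ₗ L → p ∈ₗ insertAfter c p q L
    first∈insertAfter (x ∷ xs) c∈L with x ≟ c | c∈L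
    ... | yes _  | _          = there (here refl)
    ... | no x≢c | here c≡x   = ⊥-elim (x≢c (sym c≡x))
    ... | no _   | there c∈xs = there (first∈insertAfter xs c∈xs)

    second∈insertAfter : ∀ L → c ∈ₗ L → q ∈ₗ insertAfter c p q L
    second∈insertAfter (x ∷ xs) c∈L with x ≟ c | c∈L
    ... | yes _  | _          = there (there (here refl))
    ... | no x≢c | here c≡x   = ⊥-elim (x≢c (sym c≡x))
    ... | no _   | there c∈xs = there (second∈insertAfter xs c∈xs)

    ∈-insertAfter⁻ : ∀ {w} L → w ∈ₗ insertAfter c p q L → w ∈ₗ L ⊎ w ≡ p ⊎ w ≡ q
    ∈-insertAfter⁻ (x ∷ xs) w∈ with x ≟ c | w∈
    ... | yes _ | here w≡x                   = inj₁ (here w≡x)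
    ... | yes _ | there (here w≡p)           = inj₂ (inj₁ w≡p)
    ... | yes _ | there (there (here w≡q))   = inj₂ (inj₂ w≡q)
    ... | yes _ | there (there (there w∈xs)) = inj₁ (there w∈xs)
    ... | no _  | here w≡x                   = inj₁ (here w≡x)
    ... | no _  | there w∈ with ∈-insertAfter⁻ xs w∈
    ...   | inj₁ w∈xs = inj₁ (there w∈xs)
    ...   | inj₂ new  = inj₂ new

    insertAfter-unique : ∀ L → Unique L → p ≢ q → p ∉ₗ L → q ∉ₗ L → Unique (insertAfter c p q L)
    insertAfter-unique []       _              _   _   _   = []
    insertAfter-unique (x ∷ xs) (x∉xs ∷ uniq) p≢q p∉L q∉L with x ≟ c
    ... | yes _ = ((λ x≡p → p∉L (here (sym x≡p))) ∷ (λ x≡q → q∉L (here (sym x≡q))) ∷ x∉xs)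
                ∷ (p≢q ∷ ¬Any⇒All¬ xs (p∉L ∘ there)) ∷ ¬Any⇒All¬ xs (q∉L ∘ there) ∷ uniq
    ... | no _  = All.tabulate x∉ins ∷ insertAfter-unique xs uniq p≢q (p∉L ∘ there) (q∉L ∘ there)
      where
      x∉ins : ∀ {w} → w ∈ₗ insertAfter c p q xs → x ≢ w
      x∉ins w∈ with ∈-insertAfter⁻ xs w∈
      ... | inj₁ w∈xs        = All.lookup x∉xs w∈xs
      ... | inj₂ (inj₁ refl) = λ x≡p → p∉L (here (sym x≡p))
      ... | inj₂ (inj₂ refl) = λ x≡q → q∉L (here (sym x≡q))

    length-insertAfter : ∀ L → c ∈ₗ L → length (insertAfter c p q L) ≡ 2 + length L
    length-insertAfter (x ∷ xs) c∈L with x ≟ c | c∈L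
    ... | yes _  | _          = refl
    ... | no x≢c | here c≡x   = ⊥-elim (x≢c (sym c≡x))
    ... | no _   | there c∈xs = cong suc (length-insertAfter xs c∈xs)

module _ {m n : ℕ} (f : Fin m → Fin n) (f-injective : Injective _≡_ _≡_ f) where

  cyclicNext-map : ∀ L u → cyclicNext (map f L) (f u) ≡ f (cyclicNext L u)
  cyclicNext-map []       u = refl
  cyclicNext-map (x ∷ xs) u = go x (x ∷ xs)
    where
    go : ∀ h L → nextGo (f h) (f u) (map f L) ≡ f (nextGo h u L)
    go h []       = refl
    go h (y ∷ ys) with y ≟ u
    ... | yes refl = trans (nextGo-hit (f h) (f y) (map f ys)) (trans (head-map ys) (cong f (sym (nextGo-hit h y ys))))
      where
      head-map : ∀ zs → headOr (f h) (map f zs) ≡ f (headOr h zs)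
      head-map []      = refl
      head-map (_ ∷ _) = refl
    ... | no y≢u = trans (nextGo-skip (f h) (f u) (f y) (map f ys) (y≢u ∘ f-injective))
                     (trans (go h ys) (cong f (sym (nextGo-skip h u y ys y≢u))))

↑ˡ≢↑ʳ : ∀ {m n} (i : Fin m) (j : Fin n) → i ↑ˡ n ≢ m ↑ʳ j
↑ˡ≢↑ʳ zero    j ()
↑ˡ≢↑ʳ (suc i) j eq = ↑ˡ≢↑ʳ i j (suc-injective eq)

↑ˡ∉map-↑ʳ : ∀ {m n} (i : Fin m) (L : List (Fin n)) → i ↑ˡ n ∉ₗ map (m ↑ʳ_) L
↑ˡ∉map-↑ʳ {m} i L i∈ with ∈-map⁻ (m ↑ʳ_) i∈
... | j , _ , eq = ↑ˡ≢↑ʳ i j eq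

record Cycle₄ {n} (p₀ p₁ p₂ p₃ : Fin n) : Set where
  field
    next₀ : cyclicNext (p₀ ∷ p₁ ∷ p₂ ∷ p₃ ∷ []) p₀ ≡ p₁
    next₁ : cyclicNext (p₀ ∷ p₁ ∷ p₂ ∷ p₃ ∷ []) p₁ ≡ p₂
    next₂ : cyclicNext (p₀ ∷ p₁ ∷ p₂ ∷ p₃ ∷ []) p₂ ≡ p₃
    next₃ : cyclicNext (p₀ ∷ p₁ ∷ p₂ ∷ p₃ ∷ []) p₃ ≡ p₀

cycle₄ : ∀ {n} {p₀ p₁ p₂ p₃ : Fin n} →
         p₀ ≢ p₁ → p₀ ≢ p₂ → p₀ ≢ p₃ → p₁ ≢ p₂ → p₁ ≢ p₃ → p₂ ≢ p₃ → Cycle₄ p₀ p₁ p₂ p₃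
cycle₄ {p₀ = p₀} {p₁} {p₂} {p₃} p₀≢p₁ p₀≢p₂ p₀≢p₃ p₁≢p₂ p₁≢p₃ p₂≢p₃ = record
  { next₀ = nextGo-hit p₀ p₀ (p₁ ∷ p₂ ∷ p₃ ∷ [])
  ; next₁ = trans (nextGo-skip p₀ p₁ p₀ (p₁ ∷ p₂ ∷ p₃ ∷ []) p₀≢p₁) (nextGo-hit p₀ p₁ (p₂ ∷ p₃ ∷ []))
  ; next₂ = trans (nextGo-skip p₀ p₂ p₀ (p₁ ∷ p₂ ∷ p₃ ∷ []) p₀≢p₂)
              (trans (nextGo-skip p₀ p₂ p₁ (p₂ ∷ p₃ ∷ []) p₁≢p₂) (nextGo-hit p₀ p₂ (p₃ ∷ [])))
  ; next₃ = trans (nextGo-skip p₀ p₃ p₀ (p₁ ∷ p₂ ∷ p₃ ∷ []) p₀≢p₃)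
              (trans (nextGo-skip p₀ p₃ p₁ (p₂ ∷ p₃ ∷ []) p₁≢p₃)
                (trans (nextGo-skip p₀ p₃ p₂ (p₃ ∷ []) p₂≢p₃) (nextGo-hit p₀ p₃ [])))
  }

-- The darts (a , b), (b , c), (c , a) form one orbit of the face permutation.
record Face {n} (rot : RotationSystem n) (a b c : Fin n) : Set where
  field
    a≢b    : a ≢ b
    b≢c    : b ≢ c
    c≢a    : c ≢ a
    next-b : cyclicNext (rot b) a ≡ c
    next-c : cyclicNext (rot c) b ≡ a
    next-a : cyclicNext (rot a) c ≡ b

  c∈a : Adj rot a c
  c∈a = cyclicNext≢⇒∈ (rot a) c (λ moved → b≢c (trans (sym next-a) moved))

rotateFace : ∀ {n} {rot : RotationSystem n} {a b c} → Face rot a b c → Face rot b c a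
rotateFace F = record
  { a≢b = b≢c ; b≢c = c≢a ; c≢a = a≢b ; next-b = next-c ; next-c = next-a ; next-a = next-b }
  where open Face F

sumFin : ∀ {n} → (Fin n → ℕ) → ℕ
sumFin f = sum (toList (tabulate f))

sumFin-cong : ∀ {n} {f g : Fin n → ℕ} → (∀ v → f v ≡ g v) → sumFin f ≡ sumFin g
sumFin-cong {zero}  f≗g = refl
sumFin-cong {suc n} f≗g = cong₂ _+_ (f≗g zero) (sumFin-cong (f≗g ∘ suc))

sumFin-+ : ∀ {n} (f g : Fin n → ℕ) → sumFin (λ v → f v + g v) ≡ sumFin f + sumFin g
sumFin-+ {zero}  f g = refl
sumFin-+ {suc n} f g = begin
  f zero + g zero + sumFin (λ v → f (suc v) + g (suc v))   ≡⟨ cong (f zero + g zero +_) (sumFin-+ (f ∘ suc) (g ∘ suc)) ⟩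
  f zero + g zero + (sumFin (f ∘ suc) + sumFin (g ∘ suc)) ≡⟨ interchange (f zero) (g zero) _ _ ⟩
  f zero + sumFin (f ∘ suc) + (g zero + sumFin (g ∘ suc)) ∎
  where open ≡-Reasoning

sumFin-indicator : ∀ {n} (a : Fin n) k → sumFin (λ v → if does (v ≟ a) then k else 0) ≡ k
sumFin-indicator {suc n} zero    k = trans (cong (k +_) (sumFin-const-0 n)) (+-identityʳ k)
  where
  sumFin-const-0 : ∀ n → sumFin {n} (λ _ → 0) ≡ 0
  sumFin-const-0 zero    = refl
  sumFin-const-0 (suc n) = sumFin-const-0 n
sumFin-indicator {suc n} (suc a) k = sumFin-indicator a k

-- Adding 3 vertices and 18 darts (9 edges, 6 faces) preserves Euler's formula.
euler-step : ∀ n d → n + d / 3 ≡ d / 2 + 2 → 3 + n + (d + 18) / 3 ≡ (d + 18) / 2 + 2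
euler-step n d euler = begin
  3 + n + (d + 18) / 3   ≡⟨ cong (3 + n +_) (+-distrib-/-∣ʳ d (divides 6 refl)) ⟩
  3 + n + (d / 3 + 6)    ≡⟨ regroup₁ n (d / 3) ⟩
  (n + d / 3) + 9        ≡⟨ cong (_+ 9) euler ⟩
  (d / 2 + 2) + 9        ≡⟨ regroup₂ (d / 2) ⟩
  (d / 2 + 9) + 2        ≡⟨ cong (_+ 2) (sym (+-distrib-/-∣ʳ d (divides 9 refl))) ⟩
  (d + 18) / 2 + 2       ∎
  where
  open ≡-Reasoning
  regroup₁ : ∀ p q → 3 + p + (q + 6) ≡ (p + q) + 9
  regroup₁ = solve-∀
  regroup₂ : ∀ p → (p + 2) + 9 ≡ (p + 9) + 2
  regroup₂ = solve-∀

-- Octahedral insertion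

module Octahedron (G : Triangulation) {a b c : Fin (Triangulation.n G)} (F : Face (Triangulation.rot G) a b c) where

  open Triangulation G
  open Face F

  ⇑ : Fin n → Fin (3 + n)
  ⇑ = 3 ↑ʳ_

  ⇑-injective : Injective _≡_ _≡_ ⇑
  ⇑-injective {i} {j} = ↑ʳ-injective 3 i j

  ⇑-≢ : ∀ {u v} → u ≢ v → ⇑ u ≢ ⇑ v
  ⇑-≢ u≢v = u≢v ∘ ⇑-injective

  x y z : Fin (3 + n)
  x = # 0
  y = # 1
  z = # 2

  -- The face a b c is replaced by the seven faces x y z, b c x, c a y, a b z, x c y, y a z, z b x,
  -- so x, y, z lie opposite a, b, c; around a the new neighbours y, z go between c and b, and
  -- likewise around b and c.
  rotOld : Fin n → List (Fin (3 + n))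
  rotOld v = if does (v ≟ a) then insertAfter (⇑ c) y z (map ⇑ (rot a))
             else if does (v ≟ b) then insertAfter (⇑ a) z x (map ⇑ (rot b))
             else if does (v ≟ c) then insertAfter (⇑ b) x y (map ⇑ (rot c))
             else map ⇑ (rot v)

  rot' : RotationSystem (3 + n)
  rot' zero                = ⇑ c ∷ ⇑ b ∷ z ∷ y ∷ []
  rot' (suc zero)          = ⇑ a ∷ ⇑ c ∷ x ∷ z ∷ []
  rot' (suc (suc zero))    = ⇑ b ∷ ⇑ a ∷ y ∷ x ∷ []
  rot' (suc (suc (suc v))) = rotOld v

  rot'-a : rot' (⇑ a) ≡ insertAfter (⇑ c) y z (map ⇑ (rot a))
  rot'-a with a ≟ a
  ... | yes _   = refl
  ... | no a≢a  = ⊥-elim (a≢a refl)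

  rot'-b : rot' (⇑ b) ≡ insertAfter (⇑ a) z x (map ⇑ (rot b))
  rot'-b with b ≟ a
  ... | yes b≡a = ⊥-elim (a≢b (sym b≡a))
  ... | no _ with b ≟ b
  ...   | yes _  = refl
  ...   | no b≢b = ⊥-elim (b≢b refl)

  rot'-c : rot' (⇑ c) ≡ insertAfter (⇑ b) x y (map ⇑ (rot c))
  rot'-c with c ≟ a
  ... | yes c≡a = ⊥-elim (c≢a c≡a)
  ... | no _ with c ≟ b
  ...   | yes c≡b = ⊥-elim (b≢c (sym c≡b))
  ...   | no _ with c ≟ c
  ...     | yes _  = refl
  ...     | no c≢c = ⊥-elim (c≢c refl)

  ⇑c∈⇑a : ⇑ c ∈ₗ map ⇑ (rot a)
  ⇑c∈⇑a = ∈-map⁺ ⇑ c∈a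

  ⇑a∈⇑b : ⇑ a ∈ₗ map ⇑ (rot b)
  ⇑a∈⇑b = ∈-map⁺ ⇑ (Face.c∈a (rotateFace F))

  ⇑b∈⇑c : ⇑ b ∈ₗ map ⇑ (rot c)
  ⇑b∈⇑c = ∈-map⁺ ⇑ (Face.c∈a (rotateFace (rotateFace F)))

  new∉ : ∀ (i : Fin 3) v → i ↑ˡ n ∉ₗ map ⇑ (rot v)
  new∉ i v = ↑ˡ∉map-↑ʳ i (rot v)

  next-a-c : cyclicNext (rot' (⇑ a)) (⇑ c) ≡ y
  next-a-c rewrite rot'-a = cyclicNext-insertAfter-anchor (⇑ c) y z _ ⇑c∈⇑a

  next-a-y : cyclicNext (rot' (⇑ a)) y ≡ z
  next-a-y rewrite rot'-a = cyclicNext-insertAfter-first (⇑ c) y z _ ⇑c∈⇑a (new∉ (# 1) a)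

  next-a-z : cyclicNext (rot' (⇑ a)) z ≡ ⇑ b
  next-a-z rewrite rot'-a =
    trans (cyclicNext-insertAfter-second (⇑ c) y z _ ⇑c∈⇑a (new∉ (# 2) a) (λ ()))
          (trans (cyclicNext-map ⇑ ⇑-injective (rot a) c) (cong ⇑ next-a))

  next-b-a : cyclicNext (rot' (⇑ b)) (⇑ a) ≡ z
  next-b-a rewrite rot'-b = cyclicNext-insertAfter-anchor (⇑ a) z x _ ⇑a∈⇑b

  next-b-z : cyclicNext (rot' (⇑ b)) z ≡ x
  next-b-z rewrite rot'-b = cyclicNext-insertAfter-first (⇑ a) z x _ ⇑a∈⇑b (new∉ (# 2) b)

  next-b-x : cyclicNext (rot' (⇑ b)) x ≡ ⇑ c
  next-b-x rewrite rot'-b =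
    trans (cyclicNext-insertAfter-second (⇑ a) z x _ ⇑a∈⇑b (new∉ (# 0) b) (λ ()))
          (trans (cyclicNext-map ⇑ ⇑-injective (rot b) a) (cong ⇑ next-b))

  next-c-b : cyclicNext (rot' (⇑ c)) (⇑ b) ≡ x
  next-c-b rewrite rot'-c = cyclicNext-insertAfter-anchor (⇑ b) x y _ ⇑b∈⇑c

  next-c-x : cyclicNext (rot' (⇑ c)) x ≡ y
  next-c-x rewrite rot'-c = cyclicNext-insertAfter-first (⇑ b) x y _ ⇑b∈⇑c (new∉ (# 0) c)

  next-c-y : cyclicNext (rot' (⇑ c)) y ≡ ⇑ a
  next-c-y rewrite rot'-c =
    trans (cyclicNext-insertAfter-second (⇑ b) x y _ ⇑b∈⇑c (new∉ (# 1) c) (λ ()))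
          (trans (cyclicNext-map ⇑ ⇑-injective (rot c) b) (cong ⇑ next-c))

  around-x : Cycle₄ (⇑ c) (⇑ b) z y
  around-x = cycle₄ (⇑-≢ (b≢c ∘ sym)) (λ ()) (λ ()) (λ ()) (λ ()) (λ ())

  around-y : Cycle₄ (⇑ a) (⇑ c) x z
  around-y = cycle₄ (⇑-≢ (c≢a ∘ sym)) (λ ()) (λ ()) (λ ()) (λ ()) (λ ())

  around-z : Cycle₄ (⇑ b) (⇑ a) y x
  around-z = cycle₄ (⇑-≢ (a≢b ∘ sym)) (λ ()) (λ ()) (λ ()) (λ ()) (λ ())

  -- The dart (u , v) is not one of the darts (a , b), (b , c), (c , a) of the destroyed face.
  OffFace : Fin n → Fin n → Set
  OffFace u v = (v ≡ a → u ≢ c) × (v ≡ b → u ≢ a) × (v ≡ c → u ≢ b)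

  offFace-away : ∀ {u v} → u ≢ a → u ≢ b → u ≢ c → OffFace u v
  offFace-away u≢a u≢b u≢c = (λ _ → u≢c) , (λ _ → u≢a) , (λ _ → u≢b)

  offFace-step : ∀ {u v w} → cyclicNext (rot w) v ≡ u → OffFace u v → OffFace v w
  offFace-step {u} back (h₁ , h₂ , h₃) =
      (λ w≡a v≡c → h₃ v≡c (trans (sym (subst₂ returns w≡a v≡c back)) next-a))
    , (λ w≡b v≡a → h₁ v≡a (trans (sym (subst₂ returns w≡b v≡a back)) next-b))
    , (λ w≡c v≡b → h₂ v≡b (trans (sym (subst₂ returns w≡c v≡b back)) next-c))
    where
    returns : Fin n → Fin n → Set
    returns s t = cyclicNext (rot s) t ≡ u

  next-old : ∀ {u v} → OffFace u v → cyclicNext (rot' (⇑ v)) (⇑ u) ≡ ⇑ (cyclicNext (rot v) u)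
  next-old {u} {v} (h₁ , h₂ , h₃) with v ≟ a
  ... | yes refl = trans (cyclicNext-insertAfter-other (⇑ c) y z (map ⇑ (rot v)) (⇑ u) (⇑-≢ (h₁ refl)) (λ ()) (λ ()))
                         (cyclicNext-map ⇑ ⇑-injective (rot v) u)
  ... | no _ with v ≟ b
  ...   | yes refl = trans (cyclicNext-insertAfter-other (⇑ a) z x (map ⇑ (rot v)) (⇑ u) (⇑-≢ (h₂ refl)) (λ ()) (λ ()))
                           (cyclicNext-map ⇑ ⇑-injective (rot v) u)
  ...   | no _ with v ≟ c
  ...     | yes refl = trans (cyclicNext-insertAfter-other (⇑ b) x y (map ⇑ (rot v)) (⇑ u) (⇑-≢ (h₃ refl)) (λ ()) (λ ()))
                             (cyclicNext-map ⇑ ⇑-injective (rot v) u)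
  ...     | no _     = cyclicNext-map ⇑ ⇑-injective (rot v) u

  adj-⇑ : ∀ u {v} → Adj rot u v → Adj rot' (⇑ u) (⇑ v)
  adj-⇑ u v∈u with u ≟ a
  ... | yes refl = ∈-insertAfter⁺ (⇑ c) y z (map ⇑ (rot u)) (∈-map⁺ ⇑ v∈u)
  ... | no _ with u ≟ b
  ...   | yes refl = ∈-insertAfter⁺ (⇑ a) z x (map ⇑ (rot u)) (∈-map⁺ ⇑ v∈u)
  ...   | no _ with u ≟ c
  ...     | yes refl = ∈-insertAfter⁺ (⇑ b) x y (map ⇑ (rot u)) (∈-map⁺ ⇑ v∈u)
  ...     | no _     = ∈-map⁺ ⇑ v∈u

  OldNeighbour : Fin n → Fin (3 + n) → Set
  OldNeighbour u w = Σ (Fin n) λ v → w ≡ ⇑ v × Adj rot u v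

  NewNeighbour : Fin n → Fin (3 + n) → Set
  NewNeighbour u w = (u ≡ a × (w ≡ y ⊎ w ≡ z)) ⊎ (u ≡ b × (w ≡ z ⊎ w ≡ x)) ⊎ (u ≡ c × (w ≡ x ⊎ w ≡ y))

  old : ∀ {u w} → w ∈ₗ map ⇑ (rot u) → OldNeighbour u w
  old w∈ with ∈-map⁻ ⇑ w∈
  ... | v , v∈u , w≡⇑v = v , w≡⇑v , v∈u

  neighbours-⇑ : ∀ u {w} → Adj rot' (⇑ u) w → OldNeighbour u w ⊎ NewNeighbour u w
  neighbours-⇑ u {w} w∈ with u ≟ a
  ... | yes refl with ∈-insertAfter⁻ (⇑ c) y z (map ⇑ (rot u)) w∈
  ...   | inj₁ w∈old = inj₁ (old w∈old)
  ...   | inj₂ new   = inj₂ (inj₁ (refl , new))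
  neighbours-⇑ u w∈ | no _ with u ≟ b
  ... | yes refl with ∈-insertAfter⁻ (⇑ a) z x (map ⇑ (rot u)) w∈
  ...   | inj₁ w∈old = inj₁ (old w∈old)
  ...   | inj₂ new   = inj₂ (inj₂ (inj₁ (refl , new)))
  neighbours-⇑ u w∈ | no _ | no _ with u ≟ c
  ... | yes refl with ∈-insertAfter⁻ (⇑ b) x y (map ⇑ (rot u)) w∈
  ...   | inj₁ w∈old = inj₁ (old w∈old)
  ...   | inj₂ new   = inj₂ (inj₂ (inj₂ (refl , new)))
  neighbours-⇑ u w∈ | no _ | no _ | no _ = inj₁ (old w∈)

  adj-⇑⁻ : ∀ u {w} → u ≢ a → u ≢ b → u ≢ c → Adj rot' (⇑ u) w → OldNeighbour u w
  adj-⇑⁻ u u≢a u≢b u≢c w∈ with neighbours-⇑ u w∈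
  ... | inj₁ oldNeighbour            = oldNeighbour
  ... | inj₂ (inj₁ (u≡a , _))        = ⊥-elim (u≢a u≡a)
  ... | inj₂ (inj₂ (inj₁ (u≡b , _))) = ⊥-elim (u≢b u≡b)
  ... | inj₂ (inj₂ (inj₂ (u≡c , _))) = ⊥-elim (u≢c u≡c)

  y∈⇑a : Adj rot' (⇑ a) y
  y∈⇑a = subst (y ∈ₗ_) (sym rot'-a) (first∈insertAfter (⇑ c) y z _ ⇑c∈⇑a)

  z∈⇑a : Adj rot' (⇑ a) z
  z∈⇑a = subst (z ∈ₗ_) (sym rot'-a) (second∈insertAfter (⇑ c) y z _ ⇑c∈⇑a)

  z∈⇑b : Adj rot' (⇑ b) z
  z∈⇑b = subst (z ∈ₗ_) (sym rot'-b) (first∈insertAfter (⇑ a) z x _ ⇑a∈⇑b)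

  x∈⇑b : Adj rot' (⇑ b) x
  x∈⇑b = subst (x ∈ₗ_) (sym rot'-b) (second∈insertAfter (⇑ a) z x _ ⇑a∈⇑b)

  x∈⇑c : Adj rot' (⇑ c) x
  x∈⇑c = subst (x ∈ₗ_) (sym rot'-c) (first∈insertAfter (⇑ b) x y _ ⇑b∈⇑c)

  y∈⇑c : Adj rot' (⇑ c) y
  y∈⇑c = subst (y ∈ₗ_) (sym rot'-c) (second∈insertAfter (⇑ b) x y _ ⇑b∈⇑c)

  closes : ∀ {u w} v → cyclicNext (rot' v) u ≡ w → cyclicNext (rot' w) v ≡ u →
           cyclicNext (rot' (cyclicNext (rot' v) u)) v ≡ u
  closes v refl back = back

  triangular-offFace : ∀ {u v} → Adj rot u v → OffFace u v →
                       cyclicNext (rot' (cyclicNext (rot' (⇑ v)) (⇑ u))) (⇑ v) ≡ ⇑ u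
  triangular-offFace {u} {v} v∈u off =
    closes (⇑ v) (next-old off) (trans (next-old (offFace-step back off)) (cong ⇑ back))
    where
    back : cyclicNext (rot (cyclicNext (rot v) u)) v ≡ u
    back = triangular u v v∈u

  triangular-old : ∀ u v → Adj rot u v → cyclicNext (rot' (cyclicNext (rot' (⇑ v)) (⇑ u))) (⇑ v) ≡ ⇑ u
  triangular-old u v v∈u = by-cases (v ≟ a) (v ≟ b) (v ≟ c)
    where
    by-cases : Dec (v ≡ a) → Dec (v ≡ b) → Dec (v ≡ c) →
               cyclicNext (rot' (cyclicNext (rot' (⇑ v)) (⇑ u))) (⇑ v) ≡ ⇑ u
    by-cases (yes refl) _ _ with u ≟ c
    ... | yes refl = closes (⇑ a) next-a-c (Cycle₄.next₀ around-y)
    ... | no u≢c   = triangular-offFace v∈u ((λ _ → u≢c) , (⊥-elim ∘ a≢b) , (λ v≡c → ⊥-elim (c≢a (sym v≡c))))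
    by-cases (no v≢a) (yes refl) _ with u ≟ a
    ... | yes refl = closes (⇑ b) next-b-a (Cycle₄.next₀ around-z)
    ... | no u≢a   = triangular-offFace v∈u (⊥-elim ∘ v≢a , (λ _ → u≢a) , (⊥-elim ∘ b≢c))
    by-cases (no v≢a) (no v≢b) (yes refl) with u ≟ b
    ... | yes refl = closes (⇑ c) next-c-b (Cycle₄.next₀ around-x)
    ... | no u≢b   = triangular-offFace v∈u (⊥-elim ∘ v≢a , ⊥-elim ∘ v≢b , (λ _ → u≢b))
    by-cases (no v≢a) (no v≢b) (no v≢c) = triangular-offFace v∈u (⊥-elim ∘ v≢a , ⊥-elim ∘ v≢b , ⊥-elim ∘ v≢c)

  triangular' : AllFacesTriangles rot'
  triangular' zero _ (here refl)                                 = closes (⇑ c) next-c-x (Cycle₄.next₁ around-y)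
  triangular' zero _ (there (here refl))                         = closes (⇑ b) next-b-x next-c-b
  triangular' zero _ (there (there (here refl)))                 = closes z (Cycle₄.next₃ around-z) next-b-z
  triangular' zero _ (there (there (there (here refl))))         = closes y (Cycle₄.next₂ around-y) (Cycle₄.next₂ around-z)
  triangular' (suc zero) _ (here refl)                           = closes (⇑ a) next-a-y (Cycle₄.next₁ around-z)
  triangular' (suc zero) _ (there (here refl))                   = closes (⇑ c) next-c-y next-a-c
  triangular' (suc zero) _ (there (there (here refl)))           = closes x (Cycle₄.next₃ around-x) next-c-x
  triangular' (suc zero) _ (there (there (there (here refl))))   = closes z (Cycle₄.next₂ around-z) (Cycle₄.next₂ around-x)
  triangular' (suc (suc zero)) _ (here refl)                     = closes (⇑ b) next-b-z (Cycle₄.next₁ around-x)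
  triangular' (suc (suc zero)) _ (there (here refl))             = closes (⇑ a) next-a-z next-b-a
  triangular' (suc (suc zero)) _ (there (there (here refl)))     = closes y (Cycle₄.next₃ around-y) next-a-y
  triangular' (suc (suc zero)) _ (there (there (there (here refl)))) = closes x (Cycle₄.next₂ around-x) (Cycle₄.next₂ around-y)
  triangular' (suc (suc (suc u))) w w∈ with neighbours-⇑ u w∈
  ... | inj₁ (v , refl , v∈u)                   = triangular-old u v v∈u
  ... | inj₂ (inj₁ (refl , inj₁ refl))          = closes y (Cycle₄.next₀ around-y) next-c-y
  ... | inj₂ (inj₁ (refl , inj₂ refl))          = closes z (Cycle₄.next₁ around-z) (Cycle₄.next₃ around-y)
  ... | inj₂ (inj₂ (inj₁ (refl , inj₁ refl)))   = closes z (Cycle₄.next₀ around-z) next-a-z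
  ... | inj₂ (inj₂ (inj₁ (refl , inj₂ refl)))   = closes x (Cycle₄.next₁ around-x) (Cycle₄.next₃ around-z)
  ... | inj₂ (inj₂ (inj₂ (refl , inj₁ refl)))   = closes x (Cycle₄.next₀ around-x) next-b-x
  ... | inj₂ (inj₂ (inj₂ (refl , inj₂ refl)))   = closes y (Cycle₄.next₁ around-y) (Cycle₄.next₃ around-x)

  symm' : ∀ u v → Adj rot' u v → Adj rot' v u
  symm' zero _ (here refl)                                 = x∈⇑c
  symm' zero _ (there (here refl))                         = x∈⇑b
  symm' zero _ (there (there (here refl)))                 = there (there (there (here refl)))
  symm' zero _ (there (there (there (here refl))))         = there (there (here refl))
  symm' (suc zero) _ (here refl)                           = y∈⇑a
  symm' (suc zero) _ (there (here refl))                   = y∈⇑c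
  symm' (suc zero) _ (there (there (here refl)))           = there (there (there (here refl)))
  symm' (suc zero) _ (there (there (there (here refl))))   = there (there (here refl))
  symm' (suc (suc zero)) _ (here refl)                     = z∈⇑b
  symm' (suc (suc zero)) _ (there (here refl))             = z∈⇑a
  symm' (suc (suc zero)) _ (there (there (here refl)))     = there (there (there (here refl)))
  symm' (suc (suc zero)) _ (there (there (there (here refl)))) = there (there (here refl))
  symm' (suc (suc (suc u))) w w∈ with neighbours-⇑ u w∈
  ... | inj₁ (v , refl , v∈u)                 = adj-⇑ v (symm u v v∈u)
  ... | inj₂ (inj₁ (refl , inj₁ refl))        = here refl
  ... | inj₂ (inj₁ (refl , inj₂ refl))        = there (here refl)
  ... | inj₂ (inj₂ (inj₁ (refl , inj₁ refl))) = here refl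
  ... | inj₂ (inj₂ (inj₁ (refl , inj₂ refl))) = there (here refl)
  ... | inj₂ (inj₂ (inj₂ (refl , inj₁ refl))) = here refl
  ... | inj₂ (inj₂ (inj₂ (refl , inj₂ refl))) = there (here refl)

  noLoops' : ∀ v → ¬ Adj rot' v v
  noLoops' zero (there (there (here ())))
  noLoops' zero (there (there (there (here ()))))
  noLoops' (suc zero) (there (there (here ())))
  noLoops' (suc zero) (there (there (there (here ()))))
  noLoops' (suc (suc zero)) (there (there (here ())))
  noLoops' (suc (suc zero)) (there (there (there (here ()))))
  noLoops' (suc (suc (suc u))) u∈u with neighbours-⇑ u u∈u
  ... | inj₁ (v , ⇑u≡⇑v , v∈u)               = noLoops u (subst (_∈ₗ rot u) (sym (⇑-injective ⇑u≡⇑v)) v∈u)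
  ... | inj₂ (inj₁ (_ , inj₁ ()))
  ... | inj₂ (inj₁ (_ , inj₂ ()))
  ... | inj₂ (inj₂ (inj₁ (_ , inj₁ ())))
  ... | inj₂ (inj₂ (inj₁ (_ , inj₂ ())))
  ... | inj₂ (inj₂ (inj₂ (_ , inj₁ ())))
  ... | inj₂ (inj₂ (inj₂ (_ , inj₂ ())))

  noMulti' : ∀ v → Unique (rot' v)
  noMulti' zero             = (⇑-≢ (b≢c ∘ sym) ∷ (λ ()) ∷ (λ ()) ∷ []) ∷ ((λ ()) ∷ (λ ()) ∷ []) ∷ ((λ ()) ∷ []) ∷ [] ∷ []
  noMulti' (suc zero)       = (⇑-≢ (c≢a ∘ sym) ∷ (λ ()) ∷ (λ ()) ∷ []) ∷ ((λ ()) ∷ (λ ()) ∷ []) ∷ ((λ ()) ∷ []) ∷ [] ∷ []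
  noMulti' (suc (suc zero)) = (⇑-≢ (a≢b ∘ sym) ∷ (λ ()) ∷ (λ ()) ∷ []) ∷ ((λ ()) ∷ (λ ()) ∷ []) ∷ ((λ ()) ∷ []) ∷ [] ∷ []
  noMulti' (suc (suc (suc u))) with u ≟ a
  ... | yes refl = insertAfter-unique (⇑ c) y z _ (map⁺ ⇑-injective (noMulti u)) (λ ()) (new∉ (# 1) u) (new∉ (# 2) u)
  ... | no _ with u ≟ b
  ...   | yes refl = insertAfter-unique (⇑ a) z x _ (map⁺ ⇑-injective (noMulti u)) (λ ()) (new∉ (# 2) u) (new∉ (# 0) u)
  ...   | no _ with u ≟ c
  ...     | yes refl = insertAfter-unique (⇑ b) x y _ (map⁺ ⇑-injective (noMulti u)) (λ ()) (new∉ (# 0) u) (new∉ (# 1) u)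
  ...     | no _     = map⁺ ⇑-injective (noMulti u)

  reach-trans : ∀ {u v w} → Reach rot' u v → Reach rot' v w → Reach rot' u w
  reach-trans u⇝v here              = u⇝v
  reach-trans u⇝v (step v⇝w' w'∼w) = step (reach-trans u⇝v v⇝w') w'∼w

  reach-⇑ : ∀ {u v} → Reach rot u v → Reach rot' (⇑ u) (⇑ v)
  reach-⇑ here             = here
  reach-⇑ (step u⇝w w∼v) = step (reach-⇑ u⇝w) (adj-⇑ _ w∼v)

  reach-⇑a : ∀ u → Reach rot' u (⇑ a)
  reach-⇑a zero                = reach-trans (step here (here refl)) (reach-⇑ (connected c a))
  reach-⇑a (suc zero)          = step here (here refl)
  reach-⇑a (suc (suc zero))    = step here (there (here refl))
  reach-⇑a (suc (suc (suc u))) = reach-⇑ (connected u a)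

  reach-from-⇑a : ∀ v → Reach rot' (⇑ a) v
  reach-from-⇑a zero                = step (reach-⇑ (connected a b)) x∈⇑b
  reach-from-⇑a (suc zero)          = step here y∈⇑a
  reach-from-⇑a (suc (suc zero))    = step here z∈⇑a
  reach-from-⇑a (suc (suc (suc v))) = reach-⇑ (connected a v)

  connected' : ∀ u v → Reach rot' u v
  connected' u v = reach-trans (reach-⇑a u) (reach-from-⇑a v)

  corner : Fin n → Fin n → ℕ
  corner s v = if does (v ≟ s) then 2 else 0

  degreeGain : Fin n → ℕ
  degreeGain v = corner a v + (corner b v + corner c v)

  degree-insertAfter : ∀ {v} s p q → s ∈ₗ map ⇑ (rot v) → length (insertAfter s p q (map ⇑ (rot v))) ≡ degree rot v + 2
  degree-insertAfter {v} s p q s∈ = trans (length-insertAfter s p q _ s∈) (trans (cong (2 +_) (length-map ⇑ (rot v))) (+-comm 2 _))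

  degree-⇑ : ∀ v → degree rot' (⇑ v) ≡ degree rot v + degreeGain v
  degree-⇑ v with v ≟ a | v ≟ b | v ≟ c
  ... | yes refl | yes a≡b | _        = ⊥-elim (a≢b a≡b)
  ... | yes refl | no _    | yes a≡c  = ⊥-elim (c≢a (sym a≡c))
  ... | yes refl | no _    | no _     = degree-insertAfter (⇑ c) y z ⇑c∈⇑a
  ... | no _     | yes refl | yes b≡c = ⊥-elim (b≢c b≡c)
  ... | no _     | yes refl | no _    = degree-insertAfter (⇑ a) z x ⇑a∈⇑b
  ... | no _     | no _    | yes refl = degree-insertAfter (⇑ b) x y ⇑b∈⇑c
  ... | no _     | no _    | no _     = trans (length-map ⇑ (rot v)) (sym (+-identityʳ (degree rot v)))

  darts' : darts rot' ≡ darts rot + 18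
  darts' = begin
    12 + sumFin (λ v → degree rot' (⇑ v))        ≡⟨ cong (12 +_) (sumFin-cong degree-⇑) ⟩
    12 + sumFin (λ v → degree rot v + degreeGain v) ≡⟨ cong (12 +_) (sumFin-+ (degree rot) degreeGain) ⟩
    12 + (darts rot + sumFin degreeGain)          ≡⟨ cong (λ g → 12 + (darts rot + g)) totalGain ⟩
    12 + (darts rot + 6)                          ≡⟨ regroup (darts rot) ⟩
    darts rot + 18                                ∎
    where
    open ≡-Reasoning
    totalGain : sumFin degreeGain ≡ 6
    totalGain = trans (sumFin-+ (corner a) _)
                  (cong₂ _+_ (sumFin-indicator a 2) (trans (sumFin-+ (corner b) (corner c))
                    (cong₂ _+_ (sumFin-indicator b 2) (sumFin-indicator c 2))))
    regroup : ∀ d → 12 + (d + 6) ≡ d + 18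
    regroup = solve-∀

  even' : (∀ v → 2 ∣ degree rot v) → ∀ v → 2 ∣ degree rot' v
  even' even zero                = divides 2 refl
  even' even (suc zero)          = divides 2 refl
  even' even (suc (suc zero))    = divides 2 refl
  even' even (suc (suc (suc v))) =
    subst (2 ∣_) (sym (degree-⇑ v)) (∣m∣n⇒∣m+n (even v) (∣m∣n⇒∣m+n (even-corner a) (∣m∣n⇒∣m+n (even-corner b) (even-corner c))))
    where
    even-corner : ∀ s → 2 ∣ corner s v
    even-corner s with does (v ≟ s)
    ... | true  = divides 1 refl
    ... | false = divides 0 refl

  G' : Triangulation
  G' = record
    { n          = 3 + n
    ; rot        = rot'
    ; noLoops    = noLoops'
    ; noMulti    = noMulti'
    ; symm       = symm'
    ; connected  = connected'
    ; triangular = triangular'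
    ; euler      = subst (λ d → 3 + n + d / 3 ≡ d / 2 + 2) (sym darts') (euler-step n (darts rot) euler)
    }

  face-xyz : Face rot' x y z
  face-xyz = record { a≢b = λ () ; b≢c = λ () ; c≢a = λ ()
                    ; next-b = Cycle₄.next₂ around-y ; next-c = Cycle₄.next₂ around-z ; next-a = Cycle₄.next₂ around-x }

  face-bcx : Face rot' (⇑ b) (⇑ c) x
  face-bcx = record { a≢b = ⇑-≢ b≢c ; b≢c = λ () ; c≢a = λ ()
                    ; next-b = next-c-b ; next-c = Cycle₄.next₀ around-x ; next-a = next-b-x }

  face-cay : Face rot' (⇑ c) (⇑ a) y
  face-cay = record { a≢b = ⇑-≢ c≢a ; b≢c = λ () ; c≢a = λ ()
                    ; next-b = next-a-c ; next-c = Cycle₄.next₀ around-y ; next-a = next-c-y }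

  face-xcy : Face rot' x (⇑ c) y
  face-xcy = record { a≢b = λ () ; b≢c = λ () ; c≢a = λ ()
                    ; next-b = next-c-x ; next-c = Cycle₄.next₁ around-y ; next-a = Cycle₄.next₃ around-x }

  face-⇑ : ∀ {p q r} → Face rot p q r → OffFace p q → Face rot' (⇑ p) (⇑ q) (⇑ r)
  face-⇑ {p} {q} {r} Fpqr off-pq = record
    { a≢b = ⇑-≢ Fpqr.a≢b ; b≢c = ⇑-≢ Fpqr.b≢c ; c≢a = ⇑-≢ Fpqr.c≢a
    ; next-b = trans (next-old off-pq) (cong ⇑ Fpqr.next-b)
    ; next-c = trans (next-old off-qr) (cong ⇑ Fpqr.next-c)
    ; next-a = trans (next-old off-rp) (cong ⇑ Fpqr.next-a)
    }
    where
    module Fpqr = Face Fpqr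
    off-qr : OffFace q r
    off-qr = offFace-step Fpqr.next-c off-pq
    off-rp : OffFace r p
    off-rp = offFace-step Fpqr.next-a off-qr

module TripleInsertion (G : Triangulation) {a b c : Fin (Triangulation.n G)} (F : Face (Triangulation.rot G) a b c) where

  open Triangulation G using (n; rot)

  module O₁ = Octahedron G F
  module O₂ = Octahedron O₁.G' O₁.face-bcx

  face-cay₂ : Face O₂.rot' (O₂.⇑ (O₁.⇑ c)) (O₂.⇑ (O₁.⇑ a)) (O₂.⇑ O₁.y)
  face-cay₂ = rotateFace (O₂.face-⇑ (rotateFace (rotateFace O₁.face-cay)) (O₂.offFace-away (λ ()) (λ ()) (λ ())))

  module O₃ = Octahedron O₂.G' face-cay₂

  G₃ : Triangulation
  G₃ = O₃.G'

  ⇑³ : Fin n → Fin (9 + n)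
  ⇑³ = 9 ↑ʳ_

  even₃ : (∀ v → 2 ∣ degree rot v) → ∀ v → 2 ∣ degree O₃.rot' v
  even₃ = O₃.even' ∘ O₂.even' ∘ O₁.even'

  adj-⇑³ : ∀ u {v} → Adj rot u v → Adj O₃.rot' (⇑³ u) (⇑³ v)
  adj-⇑³ u = O₃.adj-⇑ (O₂.⇑ (O₁.⇑ u)) ∘ O₂.adj-⇑ (O₁.⇑ u) ∘ O₁.adj-⇑ u

  adj-⇑³⁻ : ∀ u {w} → u ≢ a → u ≢ b → u ≢ c → Adj O₃.rot' (⇑³ u) w → Σ (Fin n) λ v → w ≡ ⇑³ v × Adj rot u v
  adj-⇑³⁻ u u≢a u≢b u≢c w∈ with O₃.adj-⇑⁻ (O₂.⇑ (O₁.⇑ u)) (O₂.⇑-≢ (O₁.⇑-≢ u≢c)) (O₂.⇑-≢ (O₁.⇑-≢ u≢a)) (λ ()) w∈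
  ... | v₂ , refl , v₂∈ with O₂.adj-⇑⁻ (O₁.⇑ u) (O₁.⇑-≢ u≢b) (O₁.⇑-≢ u≢c) (λ ()) v₂∈
  ...   | v₁ , refl , v₁∈ with O₁.adj-⇑⁻ u u≢a u≢b u≢c v₁∈
  ...     | v , refl , v∈ = v , refl , v∈

  face-⇑³ : ∀ {p q r} → Face rot p q r → O₁.OffFace p q → Face O₃.rot' (⇑³ p) (⇑³ q) (⇑³ r)
  face-⇑³ Fpqr (h₁ , h₂ , h₃) =
    O₃.face-⇑ (O₂.face-⇑ (O₁.face-⇑ Fpqr (h₁ , h₂ , h₃))
                         ((λ _ ()) , (λ ⇑q≡⇑c → O₁.⇑-≢ (h₃ (O₁.⇑-injective ⇑q≡⇑c))) , (λ ())))
              ((λ _ ()) , (λ ⇑q≡⇑a → O₂.⇑-≢ (O₁.⇑-≢ (h₁ (O₁.⇑-injective (O₂.⇑-injective ⇑q≡⇑a))))) , (λ ()))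

-- The gadget and domination

Dominated : ∀ {n} → RotationSystem n → Subset n → Fin n → Set
Dominated {n} rot S v = v ∈ S ⊎ Σ (Fin n) λ u → u ∈ S × Adj rot v u

DominatesOutside : ∀ {n} → RotationSystem n → Subset n → Subset n → Set
DominatesOutside rot S₀ S = ∀ v → v ∉ S₀ → Dominated rot S v

∈-++⁺ˡ : ∀ {m n} {i : Fin m} {p : Subset m} (q : Subset n) → i ∈ p → i ↑ˡ n ∈ p ++ q
∈-++⁺ˡ q hereᵥ       = hereᵥ
∈-++⁺ˡ q (thereᵥ i∈p) = thereᵥ (∈-++⁺ˡ q i∈p)

∈-++⁺ʳ : ∀ {m n} {i : Fin n} (p : Subset m) {q : Subset n} → i ∈ q → m ↑ʳ i ∈ p ++ q
∈-++⁺ʳ []      i∈q = i∈q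
∈-++⁺ʳ (_ ∷ p) i∈q = thereᵥ (∈-++⁺ʳ p i∈q)

∈-++⁻ˡ : ∀ {m n} {i : Fin m} (p : Subset m) {q : Subset n} → i ↑ˡ n ∈ p ++ q → i ∈ p
∈-++⁻ˡ {i = zero}  (_ ∷ p) hereᵥ       = hereᵥ
∈-++⁻ˡ {i = suc i} (_ ∷ p) (thereᵥ i∈) = thereᵥ (∈-++⁻ˡ p i∈)

∈-++⁻ʳ : ∀ {m n} {i : Fin n} (p : Subset m) {q : Subset n} → m ↑ʳ i ∈ p ++ q → i ∈ q
∈-++⁻ʳ []      i∈ = i∈
∈-++⁻ʳ (_ ∷ p) (thereᵥ i∈) = ∈-++⁻ʳ p i∈

∣++∣ : ∀ {m n} (p : Subset m) (q : Subset n) → ∣ p ++ q ∣ ≡ ∣ p ∣ + ∣ q ∣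
∣++∣ []            q = refl
∣++∣ (true  ∷ p) q = cong suc (∣++∣ p q)
∣++∣ (false ∷ p) q = ∣++∣ p q

-- The gadget consists of the nine vertices created by a triple insertion (indices 0 … 8)
-- followed by the three corners of the face it was inserted into (indices 9, 10, 11).
gadgetTable : Vec (List (Fin 12)) 9
gadgetTable =
    (# 7  ∷ # 9  ∷ # 2 ∷ # 1 ∷ [])
  ∷ (# 11 ∷ # 7  ∷ # 0 ∷ # 2 ∷ [])
  ∷ (# 9  ∷ # 11 ∷ # 1 ∷ # 0 ∷ [])
  ∷ (# 6  ∷ # 11 ∷ # 5 ∷ # 4 ∷ [])
  ∷ (# 10 ∷ # 6  ∷ # 3 ∷ # 5 ∷ [])
  ∷ (# 11 ∷ # 10 ∷ # 4 ∷ # 3 ∷ [])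
  ∷ (# 11 ∷ # 3  ∷ # 4 ∷ # 10 ∷ # 8 ∷ # 7 ∷ [])
  ∷ (# 9  ∷ # 0  ∷ # 1 ∷ # 11 ∷ # 6 ∷ # 8 ∷ [])
  ∷ (# 10 ∷ # 9  ∷ # 7 ∷ # 6 ∷ [])
  ∷ []

gadgetNbr : Fin 9 → List (Fin 12)
gadgetNbr = lookup gadgetTable

corners : Subset 12
corners = ⊥ {9} ++ ⊤ {3}

GadgetDominated : Subset 12 → Set
GadgetDominated S = ∀ i → i ↑ˡ 3 ∈ S ⊎ Any (_∈ S) (gadgetNbr i)

gadgetDominated? : ∀ S → Dec (GadgetDominated S)
gadgetDominated? S = all? λ i → (i ↑ˡ 3 ∈? S) ⊎-dec any? (_∈? S) (gadgetNbr i)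

corners-dominate-gadget : GadgetDominated corners
corners-dominate-gadget = from-yes (gadgetDominated? corners)

-- Exhaustive search over all 2¹² subsets of the gadget.
gadget-needs-three : ∀ S → GadgetDominated S → 3 ≤ ∣ S ∣
gadget-needs-three S dominated = ≮⇒≥ (λ small → no-small-dominator (S , small , dominated))
  where
  no-small-dominator : ¬ Σ (Subset 12) λ S → ∣ S ∣ < 3 × GadgetDominated S
  no-small-dominator = from-no (anySubset? λ S → (∣ S ∣ <? 3) ×-dec gadgetDominated? S)

module Extension {m} (rot : RotationSystem m) (rot' : RotationSystem (12 + m)) (S₀ : Subset m)
  (gadget-shape : tabulate (λ i → rot' ((i ↑ˡ 3) ↑ˡ m)) ≡ Vec.map (map (_↑ˡ m)) gadgetTable)
  (adj-lift : ∀ u {v} → Adj rot u v → Adj rot' (12 ↑ʳ u) (12 ↑ʳ v))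
  (adj-lift⁻ : ∀ u {w} → u ∉ S₀ → Adj rot' (12 ↑ʳ u) w → Σ (Fin m) λ v → w ≡ 12 ↑ʳ v × Adj rot u v)
  where

  inner : Fin 9 → Fin (12 + m)
  inner i = (i ↑ˡ 3) ↑ˡ m

  rot'-inner : ∀ i → rot' (inner i) ≡ map (_↑ˡ m) (gadgetNbr i)
  rot'-inner i = begin
    rot' (inner i)                                        ≡⟨ sym (lookup∘tabulate (rot' ∘ inner) i) ⟩
    lookup (tabulate (rot' ∘ inner)) i                    ≡⟨ cong (λ t → lookup t i) gadget-shape ⟩
    lookup (Vec.map (map (_↑ˡ m)) gadgetTable) i          ≡⟨ lookup-map i (map (_↑ˡ m)) gadgetTable ⟩
    map (_↑ˡ m) (gadgetNbr i)                             ∎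
    where open ≡-Reasoning

  inner-dominated⁻ : ∀ S S' i → Dominated rot' (S ++ S') (inner i) → i ↑ˡ 3 ∈ S ⊎ Any (_∈ S) (gadgetNbr i)
  inner-dominated⁻ S S' i (inj₁ i∈) = inj₁ (∈-++⁻ˡ S i∈)
  inner-dominated⁻ S S' i (inj₂ (u , u∈ , u∼i)) with ∈-map⁻ (_↑ˡ m) (subst (u ∈ₗ_) (rot'-inner i) u∼i)
  ... | j , j∼i , refl = inj₂ (lose j∼i (∈-++⁻ˡ S u∈))

  inner-dominated⁺ : ∀ S S' i → i ↑ˡ 3 ∈ S ⊎ Any (_∈ S) (gadgetNbr i) → Dominated rot' (S ++ S') (inner i)
  inner-dominated⁺ S S' i (inj₁ i∈) = inj₁ (∈-++⁺ˡ S' i∈)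
  inner-dominated⁺ S S' i (inj₂ any) with find any
  ... | j , j∼i , j∈ = inj₂ (j ↑ˡ m , ∈-++⁺ˡ S' j∈ , subst ((j ↑ˡ m) ∈ₗ_) (sym (rot'-inner i)) (∈-map⁺ (_↑ˡ m) j∼i))

  extend-dominating : Dominating rot S₀ → Dominating rot' (corners ++ S₀)
  extend-dominating dominating v = subst (Dominated rot' (corners ++ S₀)) (join-splitAt 12 m v) (by-part (splitAt 12 v))
    where
    by-part : ∀ s → Dominated rot' (corners ++ S₀) (join 12 m s)
    by-part (inj₁ i) with splitAt 9 i | join-splitAt 9 3 i
    ... | inj₁ j | refl = inner-dominated⁺ corners S₀ j (corners-dominate-gadget j)
    ... | inj₂ j | refl = inj₁ (∈-++⁺ˡ S₀ (∈-++⁺ʳ (⊥ {9}) ∈⊤))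
    by-part (inj₂ w) with dominating w
    ... | inj₁ w∈                 = inj₁ (∈-++⁺ʳ corners w∈)
    ... | inj₂ (u , u∈ , u∼w)     = inj₂ (12 ↑ʳ u , ∈-++⁺ʳ corners u∈ , adj-lift w u∼w)

  extend-minimal : ∀ {k} → (∀ S → DominatesOutside rot S₀ S → k ≤ ∣ S ∣) →
                   ∀ S → DominatesOutside rot' (corners ++ S₀) S → 3 + k ≤ ∣ S ∣
  extend-minimal {k} minimal S dominates with Vec.splitAt 12 S
  ... | T , S' , refl = subst (3 + k ≤_) (sym (∣++∣ T S')) (+-mono-≤ (gadget-needs-three T gadget) (minimal S' outside))
    where
    gadget : GadgetDominated T
    gadget i = inner-dominated⁻ T S' i (dominates (inner i) (∉⊥ ∘ ∈-++⁻ˡ (⊥ {9}) ∘ ∈-++⁻ˡ corners))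
    outside : DominatesOutside rot S₀ S'
    outside w w∉ with dominates (12 ↑ʳ w) (w∉ ∘ ∈-++⁻ʳ corners)
    ... | inj₁ w∈             = inj₁ (∈-++⁻ʳ T w∈)
    ... | inj₂ (u , u∈ , u∼w) with adj-lift⁻ w w∉ u∼w
    ...   | v , refl , v∼w = inj₂ (v , ∈-++⁻ʳ T u∈ , v∼w)

rot-K₃ : RotationSystem 3
rot-K₃ zero             = # 1 ∷ # 2 ∷ []
rot-K₃ (suc zero)       = # 2 ∷ # 0 ∷ []
rot-K₃ (suc (suc zero)) = # 0 ∷ # 1 ∷ []

-- The triangle drawn on the sphere: two triangular faces, 3 vertices, 3 edges.
K₃ : Triangulation
K₃ = record
  { n = 3 ; rot = rot-K₃ ; noLoops = noLoops ; noMulti = noMulti ; symm = symm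
  ; connected = connected ; triangular = triangular ; euler = refl }
  where
  noLoops : ∀ v → ¬ Adj rot-K₃ v v
  noLoops zero             (here ())
  noLoops zero             (there (here ()))
  noLoops (suc zero)       (here ())
  noLoops (suc zero)       (there (here ()))
  noLoops (suc (suc zero)) (here ())
  noLoops (suc (suc zero)) (there (here ()))
  noMulti : ∀ v → Unique (rot-K₃ v)
  noMulti zero             = ((λ ()) ∷ []) ∷ [] ∷ []
  noMulti (suc zero)       = ((λ ()) ∷ []) ∷ [] ∷ []
  noMulti (suc (suc zero)) = ((λ ()) ∷ []) ∷ [] ∷ []
  symm : ∀ u v → Adj rot-K₃ u v → Adj rot-K₃ v u
  symm zero             _ (here refl)         = there (here refl)
  symm zero             _ (there (here refl)) = here refl
  symm (suc zero)       _ (here refl)         = there (here refl)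
  symm (suc zero)       _ (there (here refl)) = here refl
  symm (suc (suc zero)) _ (here refl)         = there (here refl)
  symm (suc (suc zero)) _ (there (here refl)) = here refl
  connected : ∀ u v → Reach rot-K₃ u v
  connected zero             zero             = here
  connected zero             (suc zero)       = step here (here refl)
  connected zero             (suc (suc zero)) = step here (there (here refl))
  connected (suc zero)       zero             = step here (there (here refl))
  connected (suc zero)       (suc zero)       = here
  connected (suc zero)       (suc (suc zero)) = step here (here refl)
  connected (suc (suc zero)) zero             = step here (here refl)
  connected (suc (suc zero)) (suc zero)       = step here (there (here refl))
  connected (suc (suc zero)) (suc (suc zero)) = here
  triangular : AllFacesTriangles rot-K₃
  triangular zero             _ (here refl)         = refl
  triangular zero             _ (there (here refl)) = refl
  triangular (suc zero)       _ (here refl)         = refl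
  triangular (suc zero)       _ (there (here refl)) = refl
  triangular (suc (suc zero)) _ (here refl)         = refl
  triangular (suc (suc zero)) _ (there (here refl)) = refl

face-012 : Face rot-K₃ (# 0) (# 1) (# 2)
face-012 = record { a≢b = λ () ; b≢c = λ () ; c≢a = λ () ; next-b = refl ; next-c = refl ; next-a = refl }

face-021 : Face rot-K₃ (# 0) (# 2) (# 1)
face-021 = record { a≢b = λ () ; b≢c = λ () ; c≢a = λ () ; next-b = refl ; next-c = refl ; next-a = refl }

-- The bound on dominating sets is strengthened to sets that dominate only the vertices outside S₀:
-- it is this form that survives attaching a new gadget to a face inside S₀.
record Certificate : Set where
  field
    G          : Triangulation
    k          : ℕ
  open Triangulation G public
  field
    size       : n ≡ 4 * k
    even       : AllDegreesEven G
    {p q r}    : Fin n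
    face       : Face rot p q r
    S₀         : Subset n
    p∈S₀       : p ∈ S₀
    q∈S₀       : q ∈ S₀
    r∈S₀       : r ∈ S₀
    ∣S₀∣       : ∣ S₀ ∣ ≡ k
    dominating : Dominating rot S₀
    minimal    : ∀ S → DominatesOutside rot S₀ S → k ≤ ∣ S ∣

K₃-even : AllDegreesEven K₃
K₃-even zero             = divides 1 refl
K₃-even (suc zero)       = divides 1 refl
K₃-even (suc (suc zero)) = divides 1 refl

base : Certificate
base = record
  { G = B.G₃ ; k = 3 ; size = refl ; even = B.even₃ K₃-even
  ; face = B.face-⇑³ face-021 ((λ ()) , (λ ()) , (λ _ ()))
  ; S₀ = corners ++ [] ; p∈S₀ = corner∈ ; q∈S₀ = corner∈ ; r∈S₀ = corner∈ ; ∣S₀∣ = refl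
  ; dominating = E.extend-dominating λ ()
  ; minimal = E.extend-minimal {k = 0} λ _ _ → z≤n
  }
  where
  module B = TripleInsertion K₃ face-012
  module E = Extension {0} (λ ()) (Triangulation.rot B.G₃) [] refl (λ ()) (λ ())
  corner∈ : ∀ {j} → (9 ↑ʳ j) ↑ˡ 0 ∈ corners ++ []
  corner∈ = ∈-++⁺ˡ [] (∈-++⁺ʳ (⊥ {9}) ∈⊤)

-- Insert an octahedron x y z into the face p q r of C, then a triple insertion into x y z;
-- the new x y z join S₀, and the face x r y lies inside the new S₀.
extend : Certificate → Certificate
extend C = record
  { G = T.G₃ ; k = 3 + k ; size = trans (cong (12 +_) size) (grow k) ; even = T.even₃ (O.even' even)
  ; face = T.face-⇑³ O.face-xcy ((λ ()) , (λ ()) , (λ ()))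
  ; S₀ = corners ++ S₀ ; p∈S₀ = corner∈ ; q∈S₀ = ∈-++⁺ʳ corners r∈S₀ ; r∈S₀ = corner∈
  ; ∣S₀∣ = trans (∣++∣ corners S₀) (cong (3 +_) ∣S₀∣)
  ; dominating = E.extend-dominating dominating
  ; minimal = E.extend-minimal minimal
  }
  where
  open Certificate C
  module O = Octahedron G face

  ∉⇒≢ : ∀ {u s} → u ∉ S₀ → s ∈ S₀ → u ≢ s
  ∉⇒≢ u∉ s∈ refl = u∉ s∈

  module T = TripleInsertion O.G' O.face-xyz

  adj-lift⁻ : ∀ u {w} → u ∉ S₀ → Adj T.O₃.rot' (12 ↑ʳ u) w → Σ (Fin n) λ v → w ≡ 12 ↑ʳ v × Adj rot u v
  adj-lift⁻ u u∉ w∈ with T.adj-⇑³⁻ (O.⇑ u) (λ ()) (λ ()) (λ ()) w∈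
  ... | v₁ , refl , v₁∈ with O.adj-⇑⁻ u (∉⇒≢ u∉ p∈S₀) (∉⇒≢ u∉ q∈S₀) (∉⇒≢ u∉ r∈S₀) v₁∈
  ...   | v , refl , v∈ = v , refl , v∈

  module E = Extension rot T.O₃.rot' S₀ refl (λ u → T.adj-⇑³ (O.⇑ u) ∘ O.adj-⇑ u) adj-lift⁻

  corner∈ : ∀ {j} → (9 ↑ʳ j) ↑ˡ n ∈ corners ++ S₀
  corner∈ = ∈-++⁺ˡ S₀ (∈-++⁺ʳ (⊥ {9}) ∈⊤)

  grow : ∀ k → 12 + 4 * k ≡ 4 * (3 + k)
  grow = solve-∀

certificate : ℕ → Certificate
certificate zero    = base
certificate (suc N) = extend (certificate N)

N≤k : ∀ N → N ≤ Certificate.k (certificate N)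
N≤k zero    = z≤n
N≤k (suc N) = ≤-trans (s≤s (N≤k N)) (m≤n+m _ 2)

mainTheorem10 : ∀ (N : ℕ) → Σ Triangulation λ G → N ≤ Triangulation.n G × AllDegreesEven G × Σ ℕ λ k → DominationNumber (Triangulation.rot G) k × 4 * k ≡ Triangulation.n G
mainTheorem10 N =
  G , N≤n , even , k , ((S₀ , dominating , ∣S₀∣) , (λ S dom → minimal S (λ v _ → dom v))) , sym size
  where
  open Certificate (certificate N)
  N≤n : N ≤ n
  N≤n = subst (N ≤_) (sym size) (≤-trans (N≤k N) (m≤n*m k 4))
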